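{- Let $k$ be a positive integer. If $G$ is a graph of order $n\geq 2$, then $\chi_{\times k}(G)\geq 2\sqrt{n}-L_k(G)$.
   Context: All graphs are finite and simple. $N[v]$ is the closed neighborhood of $v$. A $k$-limited packing set is a vertex set $B$ with $|B\cap N[v]|\leq k$ for all vertices $v$; $L_k(G)$ is the maximum size of such a set. A $k$-limited packing partition of $G$ is a partition of $V(G)$ into $k$-limited packing sets; $\chi_{\times k}(G)$ is the minimum number of sets in such a partition. -}

module Defs where

open import Data.Nat using (ℕ; _≤_)
open import Data.Bool using (Bool; true; false; _∨_)
open import Data.Fin using (Fin)
open import Data.Fin.Subset using (Subset; _∩_; ∣_∣; _∈_)
open import Data.Vec using (tabulate)
open import Data.Product using (Σ; _×_)
open import Relation.Binary.PropositionalEquality using (_≡_)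
open import Relation.Nullary using (¬_)
open import Data.Fin using (_≟_)
open import Relation.Nullary.Decidable using (⌊_⌋)

record Graph (n : ℕ) : Set where
  field
    adj     : Fin n → Fin n → Bool
    symm    : ∀ u v → adj u v ≡ adj v u
    irrefl  : ∀ v → adj v v ≡ false
open Graph public

N[_]_ : ∀ {n} → Fin n → Graph n → Subset n
N[ v ] G = tabulate (λ u → ⌊ u ≟ v ⌋ ∨ adj G v u)

IsLimitedPacking : ∀ {n} → Graph n → ℕ → Subset n → Set
IsLimitedPacking G k B = ∀ v → ∣ B ∩ (N[ v ] G) ∣ ≤ k

IsLk : ∀ {n} → Graph n → ℕ → ℕ → Set
IsLk {n} G k L =
  Σ (Subset n) (λ B → IsLimitedPacking G k B × ∣ B ∣ ≡ L)
  × (∀ (B : Subset n) → IsLimitedPacking G k B → ∣ B ∣ ≤ L)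

colourClass : ∀ {n m} → (Fin n → Fin m) → Fin m → Subset n
colourClass f i = tabulate (λ u → ⌊ f u ≟ i ⌋)

-- A k-limited packing partition of V(G) into (at most) m sets, given as an
-- assignment of vertices to m classes, each of which is a k-limited packing set.
IsLimitedPackingPartition : ∀ {n} → Graph n → ℕ → (m : ℕ) → (Fin n → Fin m) → Set
IsLimitedPackingPartition G k m f = ∀ i → IsLimitedPacking G k (colourClass f i)

IsChiTimesK : ∀ {n} → Graph n → ℕ → ℕ → Set
IsChiTimesK {n} G k c =
  Σ (Fin n → Fin c) (IsLimitedPackingPartition G k c)
  × (∀ (m : ℕ) (f : Fin n → Fin m) → IsLimitedPackingPartition G k m f → c ≤ m)

{-# OPTIONS --safe #-}
-- The colour classes of a k-limited packing partition with c classes are k-limited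
-- packing sets, so each has at most L_k(G) vertices; since they cover V(G),
-- n ≤ c · L_k(G), and AM-GM gives 4n ≤ 4 c L_k(G) ≤ (c + L_k(G))², the squared form
-- of χ_{×k}(G) ≥ 2√n − L_k(G).
module Submission where

open import Data.Nat using (ℕ; _≤_; _+_; _*_; _^_; zero; suc; z≤n; s≤s)
open import Data.Nat.Properties
  using (≤-reflexive; ≤-trans; ≤-total; +-suc; +-comm; *-comm; m≤m+n;
         +-mono-≤; +-monoʳ-≤; *-monoʳ-≤; m≤n⇒∃[o]m+o≡n; module ≤-Reasoning)
open import Data.Nat.Solver using (module +-*-Solver)
open import Data.Fin using (Fin; zero; suc; _≟_)
open import Data.Fin.Subset using (Subset; inside; outside; ⊤; ⊥; _∪_; _∈_; ⋃; ∣_∣)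
open import Data.Fin.Subset.Properties using (∣⊤∣≡n; ∣⊥∣≡0; ∣p∣≤∣x∷p∣; p⊆q⇒∣p∣≤∣q∣; x∈p∪q⁺)
open import Data.List using (tabulate)
open import Data.Vec using (_∷_; [])
open import Data.Vec.Properties using (lookup⇒[]=; lookup∘tabulate)
open import Data.Product using (_,_)
open import Data.Sum using (inj₁; inj₂)
open import Function using (_∘_)
open import Relation.Nullary.Decidable using (isYes≗does; dec-true)
open import Relation.Binary.PropositionalEquality using (_≡_; refl; sym; trans; cong; subst₂)
open import Defs

private
  variable
    n c : ℕ

∣p∪q∣≤∣p∣+∣q∣ : (p q : Subset n) → ∣ p ∪ q ∣ ≤ ∣ p ∣ + ∣ q ∣
∣p∪q∣≤∣p∣+∣q∣ []            []            = z≤n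
∣p∪q∣≤∣p∣+∣q∣ (outside ∷ p) (outside ∷ q) = ∣p∪q∣≤∣p∣+∣q∣ p q
∣p∪q∣≤∣p∣+∣q∣ (outside ∷ p) (inside  ∷ q) =
  ≤-trans (s≤s (∣p∪q∣≤∣p∣+∣q∣ p q)) (≤-reflexive (sym (+-suc ∣ p ∣ ∣ q ∣)))
∣p∪q∣≤∣p∣+∣q∣ (inside  ∷ p) (x       ∷ q) =
  s≤s (≤-trans (∣p∪q∣≤∣p∣+∣q∣ p q) (+-monoʳ-≤ ∣ p ∣ (∣p∣≤∣x∷p∣ x q)))

∣⋃tabulate∣≤c*L : ∀ {L} (ps : Fin c → Subset n) → (∀ i → ∣ ps i ∣ ≤ L) →
                  ∣ ⋃ (tabulate ps) ∣ ≤ c * L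
∣⋃tabulate∣≤c*L {zero}  {n} ps _      = ≤-reflexive (∣⊥∣≡0 n)
∣⋃tabulate∣≤c*L {suc c}     ps ∣ps∣≤L =
  ≤-trans (∣p∪q∣≤∣p∣+∣q∣ (ps zero) (⋃ (tabulate (ps ∘ suc))))
          (+-mono-≤ (∣ps∣≤L zero) (∣⋃tabulate∣≤c*L (ps ∘ suc) (∣ps∣≤L ∘ suc)))

x∈⋃tabulate : ∀ {x : Fin n} (ps : Fin c → Subset n) i → x ∈ ps i → x ∈ ⋃ (tabulate ps)
x∈⋃tabulate ps zero    x∈ps = x∈p∪q⁺ (inj₁ x∈ps)
x∈⋃tabulate ps (suc i) x∈ps = x∈p∪q⁺ (inj₂ (x∈⋃tabulate (ps ∘ suc) i x∈ps))

cover⇒n≤c*L : ∀ {L} (ps : Fin c → Subset n) (cover : Fin n → Fin c) →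
              (∀ x → x ∈ ps (cover x)) → (∀ i → ∣ ps i ∣ ≤ L) → n ≤ c * L
cover⇒n≤c*L {c} {n} {L} ps cover covers ∣ps∣≤L = begin
  n                    ≡⟨ sym (∣⊤∣≡n n) ⟩
  ∣ ⊤ {n} ∣            ≤⟨ p⊆q⇒∣p∣≤∣q∣ {p = ⊤} (λ {x} _ → x∈⋃tabulate ps (cover x) (covers x)) ⟩
  ∣ ⋃ (tabulate ps) ∣  ≤⟨ ∣⋃tabulate∣≤c*L ps ∣ps∣≤L ⟩
  c * L                ∎
  where open ≤-Reasoning

x∈colourClass[fx] : (f : Fin n → Fin c) (x : Fin n) → x ∈ colourClass f (f x)
x∈colourClass[fx] f x =
  lookup⇒[]= x _ (trans (lookup∘tabulate _ x)
                        (trans (isYes≗does (f x ≟ f x)) (dec-true (f x ≟ f x) refl)))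

[a+[a+d]]²≡4a[a+d]+d² : ∀ a d → (a + (a + d)) ^ 2 ≡ 4 * (a * (a + d)) + d ^ 2
[a+[a+d]]²≡4a[a+d]+d² =
  solve 2 (λ a d → (a :+ (a :+ d)) :^ 2 := con 4 :* (a :* (a :+ d)) :+ d :^ 2) refl
  where open +-*-Solver

m≤n⇒4mn≤[m+n]² : ∀ {m n} → m ≤ n → 4 * (m * n) ≤ (m + n) ^ 2
m≤n⇒4mn≤[m+n]² {m} m≤n with d , refl ← m≤n⇒∃[o]m+o≡n m≤n =
  ≤-trans (m≤m+n _ (d ^ 2)) (≤-reflexive (sym ([a+[a+d]]²≡4a[a+d]+d² m d)))

4mn≤[m+n]² : ∀ m n → 4 * (m * n) ≤ (m + n) ^ 2
4mn≤[m+n]² m n with ≤-total m n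
... | inj₁ m≤n = m≤n⇒4mn≤[m+n]² m≤n
... | inj₂ n≤m = subst₂ _≤_ (cong (4 *_) (*-comm n m)) (cong (_^ 2) (+-comm n m))
                        (m≤n⇒4mn≤[m+n]² n≤m)

mainTheorem16 : (k : ℕ) → 1 ≤ k → (n : ℕ) → 2 ≤ n → (G : Graph n) →
    (L c : ℕ) → IsLk G k L → IsChiTimesK G k c →
    4 * n ≤ (c + L) ^ 2
mainTheorem16 _ _ n _ _ L c (_ , ∣packing∣≤L) ((f , classesArePackings) , _) = begin
  4 * n        ≤⟨ *-monoʳ-≤ 4 n≤c*L ⟩
  4 * (c * L)  ≤⟨ 4mn≤[m+n]² c L ⟩
  (c + L) ^ 2  ∎
  where
  open ≤-Reasoning
  n≤c*L : n ≤ c * L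
  n≤c*L = cover⇒n≤c*L (colourClass f) f (x∈colourClass[fx] f)
            (λ i → ∣packing∣≤L (colourClass f i) (classesArePackings i))
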